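{- Let $\mathbf{d}=(d_1,\ldots,d_n)$ be an arranged graphic sequence and let $\delta$ be a positive even integer. If $\mathbf{d}\circ\delta$ is graphic, then $\mathbf{d}\circ\delta'$ is graphic for every even integer $\delta'$ with $0<\delta'<\delta$.
   Context: A finite sequence of nonnegative integers is graphic if it is the degree sequence of some simple graph (with vertex labelling). Arranged means $d_1\ge\cdots\ge d_n$. $\mathbf{d}\circ\delta$ denotes $\mathbf{d}$ with $\delta$ appended at the end. -}

module Defs where

open import Data.Nat using (ℕ; _≤_; _≡ᵇ_)
open import Data.Nat.Properties using ()
open import Data.Bool using (Bool; true; false; T)
open import Data.Fin using (Fin; _≟_)
open import Data.Fin.Properties using ()
open import Data.Vec using (Vec; lookup; _∷ʳ_)
open import Data.List using (List; filter; length; allFin)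
open import Data.Product using (Σ; ∃; _×_)
open import Relation.Nullary using (¬_)
open import Relation.Binary.PropositionalEquality using (_≡_)
open import Relation.Nullary.Decidable using (Dec)
open import Data.Bool.Properties using (T?)

record SimpleGraph (n : ℕ) : Set where
  field
    adj       : Fin n → Fin n → Bool
    symmetric : ∀ i j → adj i j ≡ adj j i
    loopless  : ∀ i → adj i i ≡ false

open SimpleGraph public

degree : ∀ {n} → SimpleGraph n → Fin n → ℕ
degree {n} G i = length (filter (λ j → T? (adj G i j)) (allFin n))

Graphic : ∀ {n} → Vec ℕ n → Set
Graphic {n} d = Σ (SimpleGraph n) λ G → ∀ i → degree G i ≡ lookup d i

Arranged : ∀ {n} → Vec ℕ n → Set
Arranged {n} d = ∀ (i j : Fin n) → i Data.Fin.≤ j → lookup d j ≤ lookup d i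

_∘ₛ_ : ∀ {n} → Vec ℕ n → ℕ → Vec ℕ (Data.Nat.suc n)
d ∘ₛ δ = d ∷ʳ δ

{-# OPTIONS --safe #-}

-- Let K realise d with an extra isolated vertex v, and G realise d ∘ (δ + 2), so that the two
-- graphs have the same degrees away from v. Delete an edge va of G: now a has one neighbour
-- fewer than in K, so some K-edge ab is missing and can be added; then b has one neighbour too
-- many, hence an edge bc that is not in K, which we delete, and so on. Deletions only remove
-- edges outside K and additions only add edges of K, so the number of edges outside K strictly
-- decreases along this alternating trail. As v has no K-edges, no addition touches v, and the
-- trail must end by deleting a second edge at v. The result realises d ∘ δ; iterating lowers δ
-- by any even amount.

module Submission where

open import Defs
open import Data.Nat using (ℕ; _<_; zero; suc; _≤_; _∸_; _*_; _+_; s≤s; z≤n; s<s⁻¹)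
open import Data.Nat.Divisibility using (_∣_; divides)
open import Data.Vec using (Vec; []; _∷_; lookup; _∷ʳ_)
open import Data.Bool using (Bool; true; false; if_then_else_; _∧_; not)
open import Data.Bool.Properties using (T?)
open import Data.Fin using (Fin; zero; suc; fromℕ; inject₁; _≟_)
open import Data.Fin.Properties using (suc-injective)
open import Data.Fin.Relation.Unary.Top using (view; ‵fromℕ; ‵inject₁)
open import Data.List using (length; filter; tabulate)
open import Data.Maybe using (Maybe; just; nothing)
import Data.Maybe as Maybe
open import Data.Nat.Induction using (<-wellFounded)
open import Data.Nat.Properties
  using (≤-reflexive; <⇒≤; m≤n⇒m≤1+n; ≤-<-trans; +-mono-≤; +-mono-<-≤; +-mono-≤-<;
         *-cancelʳ-≤; m∸n+n≡m; *-distribʳ-+)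
import Data.Nat.Properties as ℕ
open import Data.Product using (∃-syntax; _×_; _,_; swap)
import Data.Product as Product
open import Data.Sum using (_⊎_; inj₁; inj₂)
import Data.Sum as Sum
open import Function using (_∘_; id)
open import Induction.WellFounded using (Acc; acc)
open import Relation.Nullary using (¬_; Dec; yes; no; does; contradiction)
open import Relation.Nullary.Decidable using (dec-true; dec-false; _×-dec_; _⊎-dec_)
open import Relation.Binary.PropositionalEquality
  using (_≡_; _≢_; refl; sym; trans; cong; cong₂; subst; subst₂; ≢-sym; module ≡-Reasoning)

count : ∀ {m} → (Fin m → Bool) → ℕ
count {zero}  f = 0
count {suc m} f = if f zero then suc (count (f ∘ suc)) else count (f ∘ suc)

count-cong : ∀ {m} {f g : Fin m → Bool} → (∀ j → f j ≡ g j) → count f ≡ count g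
count-cong {zero}          f≗g = refl
count-cong {suc m} {f} {g} f≗g rewrite f≗g zero =
  cong (λ c → if g zero then suc c else c) (count-cong (f≗g ∘ suc))

count-mono : ∀ {m} {f g : Fin m → Bool} → (∀ j → f j ≡ true → g j ≡ true) → count f ≤ count g
count-mono {zero} f⇒g = z≤n
count-mono {suc m} {f} {g} f⇒g with f zero in f₀ | g zero in g₀
... | true  | true  = s≤s (count-mono (f⇒g ∘ suc))
... | false | true  = m≤n⇒m≤1+n (count-mono (f⇒g ∘ suc))
... | false | false = count-mono (f⇒g ∘ suc)
... | true  | false with () ← trans (sym (f⇒g zero f₀)) g₀

count-update : ∀ {m} {f g : Fin m → Bool} y → (∀ j → j ≢ y → f j ≡ g j) →
               f y ≡ false → g y ≡ true → suc (count f) ≡ count g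
count-update {suc m} zero f≗g fy gy rewrite fy | gy =
  cong suc (count-cong (λ j → f≗g (suc j) λ ()))
count-update {suc m} {f} {g} (suc y) f≗g fy gy rewrite f≗g zero (λ ()) with g zero
... | true  = cong suc (count-update y (λ j j≢y → f≗g (suc j) (j≢y ∘ suc-injective)) fy gy)
... | false = count-update y (λ j j≢y → f≗g (suc j) (j≢y ∘ suc-injective)) fy gy

count-<-witness : ∀ {m} {f g : Fin m → Bool} → count f < count g → ∃[ j ] g j ≡ true × f j ≡ false
count-<-witness {suc m} {f} {g} f<g with f zero in f₀ | g zero in g₀
... | false | true  = zero , g₀ , f₀
... | true  | true  = Product.map suc id (count-<-witness (s<s⁻¹ f<g))
... | false | false = Product.map suc id (count-<-witness f<g)
... | true  | false = Product.map suc id (count-<-witness (<⇒≤ f<g))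

count≡0⇒false : ∀ {m} {f : Fin m → Bool} → count f ≡ 0 → ∀ j → f j ≡ false
count≡0⇒false {suc m} {f} c≡0 j with f zero in f₀
count≡0⇒false {suc m} {f} c≡0 zero    | false = f₀
count≡0⇒false {suc m} {f} c≡0 (suc j) | false = count≡0⇒false c≡0 j

count-false : ∀ {m} → count {m} (λ _ → false) ≡ 0
count-false {zero}  = refl
count-false {suc m} = count-false {m}

count-inject₁ : ∀ {m} {f : Fin (suc m) → Bool} → f (fromℕ m) ≡ false → count f ≡ count (f ∘ inject₁)
count-inject₁ {zero}      f-last rewrite f-last = refl
count-inject₁ {suc m} {f} f-last with f zero
... | true  = cong suc (count-inject₁ {f = f ∘ suc} f-last)
... | false = count-inject₁ {f = f ∘ suc} f-last

length-filter-tabulate : ∀ {m k} (p : Fin k → Bool) (h : Fin m → Fin k) →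
                         length (filter (T? ∘ p) (tabulate h)) ≡ count (p ∘ h)
length-filter-tabulate {zero}  p h = refl
length-filter-tabulate {suc m} p h with p (h zero)
... | true  = cong suc (length-filter-tabulate p (h ∘ suc))
... | false = length-filter-tabulate p (h ∘ suc)

sum : ∀ {m} → (Fin m → ℕ) → ℕ
sum {zero}  f = 0
sum {suc m} f = f zero + sum (f ∘ suc)

sum-mono : ∀ {m} {f g : Fin m → ℕ} → (∀ i → f i ≤ g i) → sum f ≤ sum g
sum-mono {zero}  f≤g = z≤n
sum-mono {suc m} f≤g = +-mono-≤ (f≤g zero) (sum-mono (f≤g ∘ suc))

sum-mono-< : ∀ {m} {f g : Fin m → ℕ} → (∀ i → f i ≤ g i) → ∀ i → f i < g i → sum f < sum g
sum-mono-< f≤g zero    f<g = +-mono-<-≤ f<g (sum-mono (f≤g ∘ suc))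
sum-mono-< f≤g (suc i) f<g = +-mono-≤-< (f≤g zero) (sum-mono-< (f≤g ∘ suc) i f<g)

module _ {m : ℕ} where

  degree-count : (G : SimpleGraph m) (x : Fin m) → degree G x ≡ count (adj G x)
  degree-count G x = length-filter-tabulate (adj G x) id

  degree-cong : (G H : SimpleGraph m) {x y : Fin m} → (∀ j → adj G x j ≡ adj H y j) →
                degree G x ≡ degree H y
  degree-cong G H {x} {y} adj≗ =
    trans (degree-count G x) (trans (count-cong adj≗) (sym (degree-count H y)))

  degree-update : (G H : SimpleGraph m) {x y : Fin m} → (∀ j → j ≢ y → adj G x j ≡ adj H x j) →
                  adj G x y ≡ false → adj H x y ≡ true → suc (degree G x) ≡ degree H x
  degree-update G H {x} {y} adj≗ Gxy Hxy =
    trans (cong suc (degree-count G x)) (trans (count-update y adj≗ Gxy Hxy) (sym (degree-count H x)))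

  degree-<-witness : (G H : SimpleGraph m) {x y : Fin m} → degree G x < degree H y →
                     ∃[ j ] adj H y j ≡ true × adj G x j ≡ false
  degree-<-witness G H {x} {y} G<H =
    count-<-witness (subst₂ _<_ (degree-count G x) (degree-count H y) G<H)

  degree≡0⇒isolated : (G : SimpleGraph m) {x : Fin m} → degree G x ≡ 0 → ∀ j → adj G x j ≡ false
  degree≡0⇒isolated G {x} deg≡0 = count≡0⇒false (trans (sym (degree-count G x)) deg≡0)

  isolated⇒degree≡0 : (G : SimpleGraph m) {x : Fin m} → (∀ j → adj G x j ≡ false) → degree G x ≡ 0
  isolated⇒degree≡0 G {x} isolated =
    trans (degree-count G x) (trans (count-cong isolated) (count-false {m}))

  adjacent⇒≢ : (G : SimpleGraph m) {x y : Fin m} → adj G x y ≡ true → x ≢ y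
  adjacent⇒≢ G {x} Gxy refl with () ← trans (sym Gxy) (loopless G x)

  OnEdge : (x y i j : Fin m) → Set
  OnEdge x y i j = (i ≡ x × j ≡ y) ⊎ (i ≡ y × j ≡ x)

  onEdge? : (x y i j : Fin m) → Dec (OnEdge x y i j)
  onEdge? x y i j = (i ≟ x ×-dec j ≟ y) ⊎-dec (i ≟ y ×-dec j ≟ x)

  OnEdge-flip : {x y i j : Fin m} → OnEdge x y i j → OnEdge x y j i
  OnEdge-flip = Sum.swap ∘ Sum.map swap swap

  adj-OnEdge : (G : SimpleGraph m) {x y i j : Fin m} →
               adj G x y ≡ true → OnEdge x y i j → adj G i j ≡ true
  adj-OnEdge G Gxy (inj₁ (refl , refl)) = Gxy
  adj-OnEdge G Gxy (inj₂ (refl , refl)) = trans (symmetric G _ _) Gxy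

  updateAdj : SimpleGraph m → (x y : Fin m) → Bool → Fin m → Fin m → Bool
  updateAdj G x y b i j = if does (onEdge? x y i j) then b else adj G i j

  module _ (G : SimpleGraph m) {x y : Fin m} {b : Bool} {i j : Fin m} where

    updateAdj-on : OnEdge x y i j → updateAdj G x y b i j ≡ b
    updateAdj-on e = cong (λ c → if c then b else adj G i j) (dec-true (onEdge? x y i j) e)

    updateAdj-off : ¬ OnEdge x y i j → updateAdj G x y b i j ≡ adj G i j
    updateAdj-off ¬e = cong (λ c → if c then b else adj G i j) (dec-false (onEdge? x y i j) ¬e)

  -- Opaque so that unification sees setEdge G x y _ b itself rather than its unfolded adjacency.
  opaque
    setEdge : (G : SimpleGraph m) (x y : Fin m) → x ≢ y → Bool → SimpleGraph m
    setEdge G x y x≢y b = record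
      { adj       = updateAdj G x y b
      ; symmetric = symmetric′
      ; loopless  = loopless′
      }
      where
      symmetric′ : ∀ i j → updateAdj G x y b i j ≡ updateAdj G x y b j i
      symmetric′ i j with onEdge? x y i j
      ... | yes e = trans (updateAdj-on G e) (sym (updateAdj-on G (OnEdge-flip e)))
      ... | no ¬e = trans (updateAdj-off G ¬e)
                          (trans (symmetric G i j) (sym (updateAdj-off G (¬e ∘ OnEdge-flip))))

      loopless′ : ∀ i → updateAdj G x y b i i ≡ false
      loopless′ i with onEdge? x y i i
      ... | yes (inj₁ (refl , i≡y)) = contradiction i≡y x≢y
      ... | yes (inj₂ (refl , i≡x)) = contradiction (sym i≡x) x≢y
      ... | no ¬e                   = trans (updateAdj-off G ¬e) (loopless G i)

  module _ {G : SimpleGraph m} {x y : Fin m} {x≢y : x ≢ y} {b : Bool} where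

    opaque
      unfolding setEdge

      adj-setEdge-on : {i j : Fin m} → OnEdge x y i j → adj (setEdge G x y x≢y b) i j ≡ b
      adj-setEdge-on = updateAdj-on G

      adj-setEdge-off : {i j : Fin m} → ¬ OnEdge x y i j → adj (setEdge G x y x≢y b) i j ≡ adj G i j
      adj-setEdge-off = updateAdj-off G

    adj-setEdge-fst : {j : Fin m} → j ≢ y → adj (setEdge G x y x≢y b) x j ≡ adj G x j
    adj-setEdge-fst j≢y = adj-setEdge-off λ where
      (inj₁ (_ , j≡y)) → j≢y j≡y
      (inj₂ (x≡y , _)) → x≢y x≡y

    adj-setEdge-snd : {j : Fin m} → j ≢ x → adj (setEdge G x y x≢y b) y j ≡ adj G y j
    adj-setEdge-snd j≢x = adj-setEdge-off λ where
      (inj₁ (y≡x , _)) → x≢y (sym y≡x)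
      (inj₂ (_ , j≡x)) → j≢x j≡x

    degree-setEdge-≢ : {u : Fin m} → u ≢ x → u ≢ y → degree (setEdge G x y x≢y b) u ≡ degree G u
    degree-setEdge-≢ u≢x u≢y = degree-cong (setEdge G x y x≢y b) G λ j → adj-setEdge-off λ where
      (inj₁ (u≡x , _)) → u≢x u≡x
      (inj₂ (u≡y , _)) → u≢y u≡y

  addEdge removeEdge : (G : SimpleGraph m) (x y : Fin m) → x ≢ y → SimpleGraph m
  addEdge    G x y x≢y = setEdge G x y x≢y true
  removeEdge G x y x≢y = setEdge G x y x≢y false

  module _ (G : SimpleGraph m) {x y : Fin m} {x≢y : x ≢ y} where

    degree-addEdge-fst : adj G x y ≡ false → degree (addEdge G x y x≢y) x ≡ suc (degree G x)
    degree-addEdge-fst Gxy = sym (degree-update G (addEdge G x y x≢y)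
      (λ _ j≢y → sym (adj-setEdge-fst j≢y)) Gxy (adj-setEdge-on (inj₁ (refl , refl))))

    degree-addEdge-snd : adj G x y ≡ false → degree (addEdge G x y x≢y) y ≡ suc (degree G y)
    degree-addEdge-snd Gxy = sym (degree-update G (addEdge G x y x≢y)
      (λ _ j≢x → sym (adj-setEdge-snd j≢x)) (trans (symmetric G y x) Gxy) (adj-setEdge-on (inj₂ (refl , refl))))

    degree-removeEdge-fst : adj G x y ≡ true → suc (degree (removeEdge G x y x≢y) x) ≡ degree G x
    degree-removeEdge-fst Gxy = degree-update (removeEdge G x y x≢y) G
      (λ _ → adj-setEdge-fst) (adj-setEdge-on (inj₁ (refl , refl))) Gxy

    degree-removeEdge-snd : adj G x y ≡ true → suc (degree (removeEdge G x y x≢y) y) ≡ degree G y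
    degree-removeEdge-snd Gxy = degree-update (removeEdge G x y x≢y) G
      (λ _ → adj-setEdge-snd) (adj-setEdge-on (inj₂ (refl , refl))) (trans (symmetric G y x) Gxy)

∧-not-mono : ∀ {a a′ k} → (a′ ≡ true → k ≡ false → a ≡ true) → a′ ∧ not k ≡ true → a ∧ not k ≡ true
∧-not-mono {a′ = true}  {k = false} a′⇒a _ rewrite a′⇒a refl refl = refl
∧-not-mono {a′ = true}  {k = true}  _ ()
∧-not-mono {a′ = false}             _ ()

module LowerDegree {m : ℕ} (K : SimpleGraph m) (v : Fin m) (v-isolated : ∀ j → adj K v j ≡ false) where

  excessRow : SimpleGraph m → Fin m → ℕ
  excessRow G i = count λ j → adj G i j ∧ not (adj K i j)

  excessEdges : SimpleGraph m → ℕ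
  excessEdges G = sum (excessRow G)

  excessRow-mono : (G H : SimpleGraph m) → (∀ i j → adj G i j ≡ true → adj K i j ≡ false → adj H i j ≡ true) →
                   ∀ i → excessRow G i ≤ excessRow H i
  excessRow-mono G H G⊆H∪K i = count-mono λ j → ∧-not-mono (G⊆H∪K i j)

  excessEdges-addEdge : (G : SimpleGraph m) {x y : Fin m} (x≢y : x ≢ y) → adj K x y ≡ true →
                        excessEdges (addEdge G x y x≢y) ≤ excessEdges G
  excessEdges-addEdge G {x} {y} x≢y Kxy = sum-mono (excessRow-mono (addEdge G x y x≢y) G new⊆G∪K)
    where
    new⊆G∪K : ∀ i j → adj (addEdge G x y x≢y) i j ≡ true → adj K i j ≡ false → adj G i j ≡ true
    new⊆G∪K i j G′ij Kij with onEdge? x y i j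
    ... | yes e with () ← trans (sym (adj-OnEdge K Kxy e)) Kij
    ... | no ¬e = trans (sym (adj-setEdge-off ¬e)) G′ij

  excessEdges-removeEdge : (G : SimpleGraph m) {x y : Fin m} (x≢y : x ≢ y) →
                           adj G x y ≡ true → adj K x y ≡ false →
                           excessEdges (removeEdge G x y x≢y) < excessEdges G
  excessEdges-removeEdge G {x} {y} x≢y Gxy Kxy =
    sum-mono-< (excessRow-mono G′ G λ i j G′ij _ → G′⊆G i j G′ij) x (≤-reflexive (count-update y
      (λ j j≢y → cong (_∧ not (adj K x j)) (adj-setEdge-fst j≢y))
      (cong (_∧ not (adj K x y)) (adj-setEdge-on (inj₁ (refl , refl))))
      (cong₂ (λ a k → a ∧ not k) Gxy Kxy)))
    where
    G′ = removeEdge G x y x≢y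

    G′⊆G : ∀ i j → adj G′ i j ≡ true → adj G i j ≡ true
    G′⊆G i j G′ij with onEdge? x y i j
    ... | yes e with () ← trans (sym (adj-setEdge-on e)) G′ij
    ... | no ¬e = trans (sym (adj-setEdge-off ¬e)) G′ij

  Agrees : SimpleGraph m → Set
  Agrees G = ∀ u → u ≢ v → degree G u ≡ degree K u

  AgreesExcept : SimpleGraph m → Fin m → Set
  AgreesExcept G x = ∀ u → u ≢ v → u ≢ x → degree G u ≡ degree K u

  record Surplus (G : SimpleGraph m) (x : Fin m) : Set where
    field
      x≢v     : x ≢ v
      surplus : degree G x ≡ suc (degree K x)
      agrees  : AgreesExcept G x

  record Deficit (G : SimpleGraph m) (y : Fin m) : Set where
    field
      y≢v     : y ≢ v
      deficit : suc (degree G y) ≡ degree K y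
      agrees  : AgreesExcept G y

  K-neighbour≢v : ∀ {u w} → adj K u w ≡ true → w ≢ v
  K-neighbour≢v {u} Kuv refl with () ← trans (sym Kuv) (trans (symmetric K u v) (v-isolated u))

  openDeficit : ∀ {G a} → Agrees G → (Gva : adj G v a ≡ true) →
                Deficit (removeEdge G v a (adjacent⇒≢ G Gva)) a
  openDeficit {G} {a} agrees Gva = record
    { y≢v     = a≢v
    ; deficit = trans (degree-removeEdge-snd G Gva) (agrees a a≢v)
    ; agrees  = λ u u≢v u≢a → trans (degree-setEdge-≢ u≢v u≢a) (agrees u u≢v)
    }
    where
    a≢v = ≢-sym (adjacent⇒≢ G Gva)

  closeSurplus : ∀ {G x} → Surplus G x → (Gxv : adj G x v ≡ true) →
                 Agrees (removeEdge G x v (adjacent⇒≢ G Gxv))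
  closeSurplus {G} {x} s Gxv u u≢v with u ≟ x
  ... | yes refl = ℕ.suc-injective (trans (degree-removeEdge-fst G Gxv) (Surplus.surplus s))
  ... | no u≢x   = trans (degree-setEdge-≢ u≢x u≢v) (Surplus.agrees s u u≢v u≢x)

  removeSurplusEdge : ∀ {G x y} → Surplus G x → (Gxy : adj G x y ≡ true) → y ≢ v →
                      Deficit (removeEdge G x y (adjacent⇒≢ G Gxy)) y
  removeSurplusEdge {G} {x} {y} s Gxy y≢v = record
    { y≢v     = y≢v
    ; deficit = trans (degree-removeEdge-snd G Gxy) (agrees y y≢v (≢-sym (adjacent⇒≢ G Gxy)))
    ; agrees  = agrees′
    }
    where
    open Surplus s
    agrees′ : AgreesExcept (removeEdge G x y (adjacent⇒≢ G Gxy)) y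
    agrees′ u u≢v u≢y with u ≟ x
    ... | yes refl = ℕ.suc-injective (trans (degree-removeEdge-fst G Gxy) surplus)
    ... | no u≢x   = trans (degree-setEdge-≢ u≢x u≢y) (agrees u u≢v u≢x)

  addDeficitEdge : ∀ {G y z} → Deficit G y → (Kyz : adj K y z ≡ true) → adj G y z ≡ false →
                   Surplus (addEdge G y z (adjacent⇒≢ K Kyz)) z
  addDeficitEdge {G} {y} {z} d Kyz Gyz = record
    { x≢v     = z≢v
    ; surplus = trans (degree-addEdge-snd G Gyz) (cong suc (agrees z z≢v (≢-sym (adjacent⇒≢ K Kyz))))
    ; agrees  = agrees′
    }
    where
    open Deficit d
    z≢v = K-neighbour≢v Kyz
    agrees′ : AgreesExcept (addEdge G y z (adjacent⇒≢ K Kyz)) z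
    agrees′ u u≢v u≢z with u ≟ y
    ... | yes refl = trans (degree-addEdge-fst G Gyz) deficit
    ... | no u≢y   = trans (degree-setEdge-≢ u≢y u≢z) (agrees u u≢v u≢y)

  fillDeficit : ∀ {G y} → Deficit G y →
                ∃[ G′ ] ∃[ z ] Surplus G′ z × degree G′ v ≡ degree G v × excessEdges G′ ≤ excessEdges G
  fillDeficit {G} {y} d =
    let z , Kyz , Gyz = degree-<-witness G K (≤-reflexive (Deficit.deficit d))
        y≢z = adjacent⇒≢ K Kyz
    in  addEdge G y z y≢z , z , addDeficitEdge d Kyz Gyz ,
        degree-setEdge-≢ (≢-sym (Deficit.y≢v d)) (≢-sym (K-neighbour≢v Kyz)) ,
        excessEdges-addEdge G y≢z Kyz

  dischargeSurplus : ∀ G x → Surplus G x → Acc _<_ (excessEdges G) →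
                     ∃[ G′ ] Agrees G′ × suc (degree G′ v) ≡ degree G v
  dischargeSurplus G x s (acc rs) with degree-<-witness K G (≤-reflexive (sym (Surplus.surplus s)))
  ... | y , Gxy , Kxy with y ≟ v
  ... | yes refl = removeEdge G x v (adjacent⇒≢ G Gxy) , closeSurplus s Gxy , degree-removeEdge-snd G Gxy
  ... | no y≢v =
    let x≢y = adjacent⇒≢ G Gxy
        G₁ , z , s₁ , deg₁ , excess₁ = fillDeficit (removeSurplusEdge s Gxy y≢v)
        G′ , agrees′ , deg′ =
          dischargeSurplus G₁ z s₁ (rs (≤-<-trans excess₁ (excessEdges-removeEdge G x≢y Gxy Kxy)))
    in  G′ , agrees′ , trans deg′ (trans deg₁ (degree-setEdge-≢ (≢-sym (Surplus.x≢v s)) (≢-sym y≢v)))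

  lowerDegree : ∀ G {δ} → Agrees G → degree G v ≡ suc (suc δ) → ∃[ G′ ] Agrees G′ × degree G′ v ≡ δ
  lowerDegree G {δ} agrees deg-v =
    let a , Gva , _ = degree-<-witness K G (subst₂ _<_ (sym (isolated⇒degree≡0 K v-isolated)) (sym deg-v) (s≤s z≤n))
        G₀ = removeEdge G v a (adjacent⇒≢ G Gva)
        G₁ , z , s₁ , deg₁ , _ = fillDeficit (openDeficit agrees Gva)
        G′ , agrees′ , deg′ = dischargeSurplus G₁ z s₁ (<-wellFounded _)
    in  G′ , agrees′ , ℕ.suc-injective (ℕ.suc-injective (begin
          suc (suc (degree G′ v)) ≡⟨ cong suc (trans deg′ deg₁) ⟩
          suc (degree G₀ v)       ≡⟨ degree-removeEdge-fst G Gva ⟩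
          degree G v              ≡⟨ deg-v ⟩
          suc (suc δ)             ∎))
    where open ≡-Reasoning

lookup-∷ʳ-fromℕ : ∀ {A : Set} {n} (d : Vec A n) x → lookup (d ∷ʳ x) (fromℕ n) ≡ x
lookup-∷ʳ-fromℕ []      x = refl
lookup-∷ʳ-fromℕ (_ ∷ d) x = lookup-∷ʳ-fromℕ d x

lookup-∷ʳ-inject₁ : ∀ {A : Set} {n} (d : Vec A n) x i → lookup (d ∷ʳ x) (inject₁ i) ≡ lookup d i
lookup-∷ʳ-inject₁ (_ ∷ d) x zero    = refl
lookup-∷ʳ-inject₁ (_ ∷ d) x (suc i) = lookup-∷ʳ-inject₁ d x i

lookup-∷ʳ-≢fromℕ : ∀ {A : Set} {n} (d : Vec A n) {x y u} → u ≢ fromℕ n →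
                   lookup (d ∷ʳ x) u ≡ lookup (d ∷ʳ y) u
lookup-∷ʳ-≢fromℕ d {x} {y} {u} u≢last with view u
... | ‵fromℕ     = contradiction refl u≢last
... | ‵inject₁ i = trans (lookup-∷ʳ-inject₁ d x i) (sym (lookup-∷ʳ-inject₁ d y i))

lowerLast : ∀ {n} → Fin (suc n) → Maybe (Fin n)
lowerLast {zero}  zero    = nothing
lowerLast {suc n} zero    = just zero
lowerLast {suc n} (suc i) = Maybe.map suc (lowerLast i)

lowerLast-fromℕ : ∀ n → lowerLast (fromℕ n) ≡ nothing
lowerLast-fromℕ zero    = refl
lowerLast-fromℕ (suc n) = cong (Maybe.map suc) (lowerLast-fromℕ n)

lowerLast-inject₁ : ∀ {n} (i : Fin n) → lowerLast (inject₁ i) ≡ just i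
lowerLast-inject₁ zero    = refl
lowerLast-inject₁ (suc i) = cong (Maybe.map suc) (lowerLast-inject₁ i)

module _ {n : ℕ} (H : SimpleGraph n) where

  private
    adjᴹ : Maybe (Fin n) → Maybe (Fin n) → Bool
    adjᴹ (just i) (just j) = adj H i j
    adjᴹ _        _        = false

    adjᴹ-sym : ∀ i j → adjᴹ i j ≡ adjᴹ j i
    adjᴹ-sym (just i) (just j) = symmetric H i j
    adjᴹ-sym (just i) nothing  = refl
    adjᴹ-sym nothing  (just j) = refl
    adjᴹ-sym nothing  nothing  = refl

    adjᴹ-irrefl : ∀ i → adjᴹ i i ≡ false
    adjᴹ-irrefl (just i) = loopless H i
    adjᴹ-irrefl nothing  = refl

    adjᴹ-nothing : ∀ i → adjᴹ i nothing ≡ false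
    adjᴹ-nothing (just i) = refl
    adjᴹ-nothing nothing  = refl

  addIsolatedVertex : SimpleGraph (suc n)
  addIsolatedVertex = record
    { adj       = λ i j → adjᴹ (lowerLast i) (lowerLast j)
    ; symmetric = λ i j → adjᴹ-sym (lowerLast i) (lowerLast j)
    ; loopless  = λ i → adjᴹ-irrefl (lowerLast i)
    }

  degree-addIsolatedVertex-fromℕ : degree addIsolatedVertex (fromℕ n) ≡ 0
  degree-addIsolatedVertex-fromℕ =
    isolated⇒degree≡0 addIsolatedVertex λ j → cong (λ i → adjᴹ i (lowerLast j)) (lowerLast-fromℕ n)

  degree-addIsolatedVertex-inject₁ : ∀ i → degree addIsolatedVertex (inject₁ i) ≡ degree H i
  degree-addIsolatedVertex-inject₁ i = begin
    degree H′ (inject₁ i)                ≡⟨ degree-count H′ (inject₁ i) ⟩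
    count (adj H′ (inject₁ i))           ≡⟨ count-inject₁ {f = adj H′ (inject₁ i)} last-false ⟩
    count (adj H′ (inject₁ i) ∘ inject₁) ≡⟨ count-cong (λ j → cong₂ adjᴹ (lowerLast-inject₁ i) (lowerLast-inject₁ j)) ⟩
    count (adj H i)                      ≡⟨ degree-count H i ⟨
    degree H i                           ∎
    where
    open ≡-Reasoning
    H′ = addIsolatedVertex
    last-false : adj H′ (inject₁ i) (fromℕ n) ≡ false
    last-false = trans (cong (adjᴹ (lowerLast (inject₁ i))) (lowerLast-fromℕ n)) (adjᴹ-nothing (lowerLast (inject₁ i)))

graphic-∘ₛ-0 : ∀ {n} (d : Vec ℕ n) → Graphic d → Graphic (d ∘ₛ 0)
graphic-∘ₛ-0 {n} d (H , degree-H) = addIsolatedVertex H , degrees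
  where
  degrees : ∀ u → degree (addIsolatedVertex H) u ≡ lookup (d ∘ₛ 0) u
  degrees u with view u
  ... | ‵fromℕ     = trans (degree-addIsolatedVertex-fromℕ H) (sym (lookup-∷ʳ-fromℕ d 0))
  ... | ‵inject₁ i =
    trans (degree-addIsolatedVertex-inject₁ H i) (trans (degree-H i) (sym (lookup-∷ʳ-inject₁ d 0 i)))

graphic-∘ₛ-lower : ∀ {n} (d : Vec ℕ n) {δ} →
                   Graphic (d ∘ₛ 0) → Graphic (d ∘ₛ suc (suc δ)) → Graphic (d ∘ₛ δ)
graphic-∘ₛ-lower {n} d {δ} (K , degree-K) (G , degree-G) =
  let G′ , agrees′ , degree-last = lowerDegree G agrees (trans (degree-G (fromℕ n)) (lookup-∷ʳ-fromℕ d _))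
  in  G′ , degrees G′ agrees′ degree-last
  where
  open LowerDegree K (fromℕ n) (degree≡0⇒isolated K (trans (degree-K (fromℕ n)) (lookup-∷ʳ-fromℕ d 0)))

  agrees : Agrees G
  agrees u u≢last = trans (degree-G u) (trans (lookup-∷ʳ-≢fromℕ d u≢last) (sym (degree-K u)))

  degrees : ∀ G′ → Agrees G′ → degree G′ (fromℕ n) ≡ δ → ∀ u → degree G′ u ≡ lookup (d ∘ₛ δ) u
  degrees G′ agrees′ degree-last u with u ≟ fromℕ n
  ... | yes refl  = trans degree-last (sym (lookup-∷ʳ-fromℕ d δ))
  ... | no u≢last = trans (agrees′ u u≢last) (trans (degree-K u) (lookup-∷ʳ-≢fromℕ d u≢last))

graphic-∘ₛ-lowerBy : ∀ {n} (d : Vec ℕ n) {δ} k →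
                     Graphic (d ∘ₛ 0) → Graphic (d ∘ₛ (k * 2 + δ)) → Graphic (d ∘ₛ δ)
graphic-∘ₛ-lowerBy d zero    graphic-d0 graphic-d = graphic-d
graphic-∘ₛ-lowerBy d (suc k) graphic-d0 graphic-d =
  graphic-∘ₛ-lowerBy d k graphic-d0 (graphic-∘ₛ-lower d graphic-d0 graphic-d)

lemma2p10 : ∀ (n : ℕ) (d : Vec ℕ n) (δ : ℕ) →
    Arranged d → Graphic d → 0 < δ → 2 ∣ δ →
    Graphic (d ∘ₛ δ) →
    ∀ (δ′ : ℕ) → 2 ∣ δ′ → 0 < δ′ → δ′ < δ → Graphic (d ∘ₛ δ′)
lemma2p10 n d _ _ graphic-d _ (divides q refl) graphic-dδ _ (divides q′ refl) _ δ′<δ =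
  graphic-∘ₛ-lowerBy d (q ∸ q′) (graphic-∘ₛ-0 d graphic-d) (subst (λ δ → Graphic (d ∘ₛ δ)) q*2≡ graphic-dδ)
  where
  q*2≡ : q * 2 ≡ (q ∸ q′) * 2 + q′ * 2
  q*2≡ = trans (cong (_* 2) (sym (m∸n+n≡m (*-cancelʳ-≤ q′ q 2 (<⇒≤ δ′<δ))))) (*-distribʳ-+ 2 (q ∸ q′) q′)
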